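{- Let $X,Y,D\in[1,\infty)$ with $D\leq\min(X,Y)$ and $\delta\in(0,1]$. Let $A\subset[X,2X]$ and $B\subset[Y,2Y]$ be sets of integers, and let $\Omega\subset A\times B$ have size $\frac{\delta}{2}|A||B|$ with $\gcd(a,b)\geq D$ for all $(a,b)\in\Omega$. Suppose $N$ is a positive integer with $|v_p(a/N)|+|v_p(b/N)|\leq 1$ for all primes $p$ and all $(a,b)\in\Omega$. Let $A'=\{a\in A: (a,b)\in\Omega \text{ for some } b\in B\}$ and $B'=\{b\in B:(a,b)\in\Omega\text{ for some } a\in A\}$. For $a\in A'$ (resp. $b \in B'$) define the defect $a_*$ (resp. $b_*$) to be the product of all primes $p$ with $v_p(a/N)\neq 0$ (resp. $v_p(b/N)\neq 0$). Then for every real $T>0$, the number of $a\in A'$ with $a_*\leq T$ is at most $2T$, and the number of $b\in B'$ with $b_*\leq T$ is at most $2T$.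
   Context: For a prime $p$ and an integer $a$, $v_p(a)$ is the largest $k$ with $p^k\mid a$, extended to rationals by $v_p(a/b)=v_p(a)-v_p(b)$. (Under the hypotheses, $v_p(a/N)\in\{ -1,0,1\}$ for every $a\in A'$ and every prime $p$, so $a_*$ is a well-defined squarefree positive integer.)
   Formalization: The parameters X, Y, D, δ and the threshold T range over the rationals instead of the reals. -}

module Defs where

open import Data.Nat using (ℕ; zero; suc; _+_; _*_)
open import Data.Nat.Divisibility using (_∣?_; divides)
open import Data.Nat.Primality using (Prime; prime?)
open import Data.Nat.Properties using (_≟_)
open import Data.Integer as ℤ using (ℤ; +_)
open import Data.Rational as ℚ using (ℚ; _/_)
open import Data.List using (List; filter; upTo)
open import Data.Nat.ListAction using (product)
open import Relation.Nullary using (yes; no; ¬_)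
open import Relation.Nullary.Decidable using (_×-dec_; ¬?)
open import Data.Product using (_×_)

-- p-adic valuation of a natural number n (meaningful for primes p and n > 0):
-- the largest k with p^k ∣ n.  Computed by repeated division, with fuel n.
valAux : ℕ → ℕ → ℕ → ℕ
valAux zero    p n = 0
valAux (suc f) p zero = 0
valAux (suc f) p (suc m) with p ∣? suc m
... | yes (divides q _) = suc (valAux f p q)
... | no _ = 0

val : ℕ → ℕ → ℕ
val p n = valAux n p n

vq : ℕ → ℕ → ℕ → ℤ
vq p a N = (+ val p a) ℤ.- (+ val p N)

-- defect a_* : product of all primes p with v_p(a/N) ≠ 0.
-- Such primes divide a or N, hence are ≤ a + N (for a, N > 0), so the
-- product over all primes equals the product over primes p ≤ a + N.
defect : ℕ → ℕ → ℕ
defect a N = product (filter (λ p → prime? p ×-dec ¬? (val p a ≟ val p N)) (upTo (suc (a + N))))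

ℕ→ℚ : ℕ → ℚ
ℕ→ℚ n = (+ n) / 1

module Submission where

-- Write a/N = u/v in lowest terms.  Since v_p(a/N) = v_p(u) - v_p(v) with u, v coprime,
-- |v_p(a/N)| = v_p(uv); so |v_p(a/N)| ≤ 1 makes uv squarefree with every prime factor in the
-- defect, whence uv ≤ a_* ≤ T.  The map a ↦ (u, v) is injective (a v = N u), so if a₁
-- maximises u and a₂ maximises v over a list of such a, the list has at most u₁v₂ elements.
-- Finally (u₁v₂)² a₂ = (u₁v₁)(u₂v₂) a₁ and a₁ ≤ 2 a₂, so (u₁v₂)² ≤ 2T² and u₁v₂ ≤ √2 T ≤ 2T.

open import Defs

module DefectCount where

  open import Algebra.Properties.CommutativeSemigroup using (xy∙z≈xz∙y; x∙yz≈yx∙z)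
  open import Data.Integer.Base as ℤ using (_⊖_; ∣_∣; +≤+)
  import Data.Integer.Properties as ℤ
  open import Data.List.Base using (List; []; _∷_; _++_; filter; length; map; upTo; applyUpTo; cartesianProduct)
  open import Data.List.Extrema.Nat using (argmax; argmax-all; f[⊥]≤f[argmax]; f[xs]≤f[argmax])
  open import Data.List.Membership.Propositional.Properties
    using (∈-filter⁺; ∈-upTo⁺; ∈-map⁻; ∈-applyUpTo⁺; ∈-cartesianProduct⁺)
  open import Data.List.Properties using (filter-notAll; length-map; length-++; length-applyUpTo)
  open import Data.List.Membership.Propositional using (_∈_)
  open import Data.List.Relation.Binary.Subset.Propositional using (_⊆_)
  open import Data.List.Relation.Unary.All as All using (All)
  open import Data.List.Relation.Unary.All.Properties using (all-filter)
  import Data.List.Relation.Unary.AllPairs as AllPairs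
  open import Data.List.Relation.Unary.Any as Any using (here; there)
  open import Data.List.Relation.Unary.Any.Properties using (¬Any[])
  open import Data.List.Relation.Unary.Unique.Propositional using (Unique)
  import Data.List.Relation.Unary.Unique.Propositional.Properties as Unique
  open import Data.Nat.Base
  open import Data.Nat.Coprimality as Coprime using (Coprime; coprime-/gcd; 1-coprimeTo)
  open import Data.Nat.Divisibility
  open import Data.Nat.DivMod using (_/_; m*[n/m]≡n)
  open import Data.Nat.GCD using (gcd; gcd[m,n]∣m; gcd[m,n]∣n; gcd[m,n]≢0; m/gcd[m,n]≢0; n/gcd[m,n]≢0)
  open import Data.Nat.Induction using (<-wellFounded)
  open import Data.Nat.ListAction using (product)
  open import Data.Nat.Primality using (Prime; prime?; euclidsLemma; prime⇒nonTrivial; productOfPrimes≢0)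
  open import Data.Nat.Primality.Factorisation using (factorise)
  open import Data.Nat.Properties
  open import Data.Nat.Tactic.RingSolver using (solve)
  open import Data.Product using (∃; ∃₂; _×_; _,_; proj₁; proj₂)
  open import Data.Product.Properties using (≡-dec)
  open import Data.Rational.Base as ℚ using (ℚ; mkℚ; *≤*; 0ℚ; 1ℚ)
  open import Data.Rational.Properties as ℚ using (↥p/↧p≡p; toℚᵘ-injective; toℚᵘ-homo-*)
  import Data.Rational.Unnormalised.Base as ℚᵘ
  import Data.Rational.Unnormalised.Properties as ℚᵘ
  open import Data.Sum using (_⊎_; inj₁; inj₂)
  open import Induction.WellFounded using (Acc; acc)
  open import Relation.Binary.Definitions using (DecidableEquality)
  open import Relation.Binary.PropositionalEquality
  open import Relation.Nullary using (¬_; Dec; yes; no; contradiction)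
  open import Relation.Nullary.Decidable using (_×-dec_; ¬?)

  module _ {p : ℕ} .{{_ : NonTrivial p}} where

    private instance
      p≢0 : NonZero p
      p≢0 = nonTrivial⇒nonZero p

    p^[1+k]*r≡p^k*r*p : ∀ k r → p ^ suc k * r ≡ p ^ k * r * p
    p^[1+k]*r≡p^k*r*p k r = trans (*-assoc p (p ^ k) r) (*-comm p (p ^ k * r))

    p∤n⇒n≢0 : ∀ {n} → ¬ p ∣ n → NonZero n
    p∤n⇒n≢0 {zero}  p∤0 = contradiction (p ∣0) p∤0
    p∤n⇒n≢0 {suc n} _   = _

    p∤1 : ¬ p ∣ 1
    p∤1 p∣1 = nonTrivial⇒≢1 (∣1⇒≡1 p∣1)

    valAux[p^k*r]≡k : ∀ {r} f k m → ¬ p ∣ r → suc m ≡ p ^ k * r → suc m ≤ f → valAux f p (suc m) ≡ k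
    valAux[p^k*r]≡k (suc f) k m p∤r eq (s≤s m≤f) with p ∣? suc m
    valAux[p^k*r]≡k {r} (suc f) zero m p∤r eq _ | yes p∣n =
      contradiction (subst (p ∣_) (trans eq (*-identityˡ r)) p∣n) p∤r
    valAux[p^k*r]≡k {r} (suc f) (suc k) m p∤r eq (s≤s m≤f) | yes (divides (suc q) n≡q*p) =
      cong suc (valAux[p^k*r]≡k f k q p∤r q≡p^k*r (≤-trans (≤-pred q<n) m≤f))
      where
      q<n : suc q < suc m
      q<n = subst (suc q <_) (sym n≡q*p) (m<m*n (suc q) p (nonTrivial⇒n>1 p))
      q≡p^k*r : suc q ≡ p ^ k * r
      q≡p^k*r = *-cancelʳ-≡ (suc q) (p ^ k * r) p (trans (sym n≡q*p) (trans eq (p^[1+k]*r≡p^k*r*p k r)))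
    valAux[p^k*r]≡k (suc f) zero _ _ _ _ | no _ = refl
    valAux[p^k*r]≡k {r} (suc f) (suc k) m p∤r eq _ | no p∤n =
      contradiction (divides (p ^ k * r) (trans eq (p^[1+k]*r≡p^k*r*p k r))) p∤n

    val[p^k*r]≡k : ∀ {r} k → ¬ p ∣ r → val p (p ^ k * r) ≡ k
    val[p^k*r]≡k {r} k p∤r with p ^ k * r in eq
    ... | zero  = contradiction eq (≢-nonZero⁻¹ (p ^ k * r) {{m*n≢0 (p ^ k) r {{m^n≢0 p k}} {{p∤n⇒n≢0 p∤r}}}})
    ... | suc m = valAux[p^k*r]≡k (suc m) k m p∤r (sym eq) ≤-refl

    p∤n⇒val≡0 : ∀ {n} → ¬ p ∣ n → val p n ≡ 0
    p∤n⇒val≡0 {n} p∤n = subst (λ m → val p m ≡ 0) (*-identityˡ n) (val[p^k*r]≡k 0 p∤n)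

    val[p^k]≡k : ∀ k → val p (p ^ k) ≡ k
    val[p^k]≡k k = subst (λ m → val p m ≡ k) (*-identityʳ (p ^ k)) (val[p^k*r]≡k k p∤1)

    coprime⇒val≡0⊎val≡0 : ∀ {m n} → Coprime m n → val p m ≡ 0 ⊎ val p n ≡ 0
    coprime⇒val≡0⊎val≡0 {m} {n} m⊥n with p ∣? m
    ... | no  p∤m = inj₁ (p∤n⇒val≡0 p∤m)
    ... | yes p∣m = inj₂ (p∤n⇒val≡0 λ p∣n → nonTrivial⇒≢1 (m⊥n (p∣m , p∣n)))

    val-factorisation : ∀ n → .{{NonZero n}} → ∃ λ r → ¬ p ∣ r × n ≡ p ^ val p n * r
    val-factorisation (suc n) = let k , r , p∤r , n≡ = split n (<-wellFounded (suc n)) in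
      r , p∤r , trans n≡ (cong (λ j → p ^ j * r) (sym (trans (cong (val p) n≡) (val[p^k*r]≡k k p∤r))))
      where
      split : ∀ n → Acc _<_ (suc n) → ∃₂ λ k r → ¬ p ∣ r × suc n ≡ p ^ k * r
      split n (acc rec) with p ∣? suc n
      ... | no  p∤n = 0 , suc n , p∤n , sym (*-identityˡ (suc n))
      ... | yes (divides (suc q) n≡q*p) =
        let k , r , p∤r , q≡ = split q (rec (subst (suc q <_) (sym n≡q*p) (m<m*n (suc q) p (nonTrivial⇒n>1 p))))
        in suc k , r , p∤r , trans n≡q*p (trans (cong (_* p) q≡) (sym (p^[1+k]*r≡p^k*r*p k r)))

    module _ (pp : Prime p) where

      val-homo-* : ∀ m n → .{{NonZero m}} → .{{NonZero n}} → val p (m * n) ≡ val p m + val p n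
      val-homo-* m n with r , p∤r , m≡ ← val-factorisation m | s , p∤s , n≡ ← val-factorisation n = begin
        val p (m * n)                    ≡⟨ cong (val p) m*n≡ ⟩
        val p (p ^ (i + j) * (r * s))    ≡⟨ val[p^k*r]≡k (i + j) p∤r*s ⟩
        i + j                            ∎
        where
        open ≡-Reasoning
        i j : ℕ
        i = val p m
        j = val p n
        p∤r*s : ¬ p ∣ r * s
        p∤r*s p∣r*s with euclidsLemma r s pp p∣r*s
        ... | inj₁ p∣r = p∤r p∣r
        ... | inj₂ p∣s = p∤s p∣s
        m*n≡ : m * n ≡ p ^ (i + j) * (r * s)
        m*n≡ = begin
          m * n                      ≡⟨ cong₂ _*_ m≡ n≡ ⟩
          p ^ i * r * (p ^ j * s)    ≡⟨ [m*n]*[o*p]≡[m*o]*[n*p] (p ^ i) r (p ^ j) s ⟩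
          p ^ i * p ^ j * (r * s)    ≡⟨ cong (_* (r * s)) (^-distribˡ-+-* p i j) ⟨
          p ^ (i + j) * (r * s)      ∎

      p^k∣n⇒k≤val : ∀ {k n} → .{{NonZero n}} → p ^ k ∣ n → k ≤ val p n
      p^k∣n⇒k≤val {k} {n} {{n≢0}} (divides q n≡q*p^k) = begin
        k                         ≤⟨ m≤n+m k (val p q) ⟩
        val p q + k               ≡⟨ cong (val p q +_) (val[p^k]≡k k) ⟨
        val p q + val p (p ^ k)   ≡⟨ val-homo-* q (p ^ k) {{q≢0}} {{m^n≢0 p k}} ⟨
        val p (q * p ^ k)         ≡⟨ cong (val p) n≡q*p^k ⟨
        val p n                   ∎
        where
        open ≤-Reasoning
        .q≢0 : NonZero q
        q≢0 = m*n≢0⇒m≢0 q {{subst NonZero n≡q*p^k n≢0}}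

  no-prime-divisor⇒∣1 : ∀ m → .{{NonZero m}} → (∀ {p} → Prime p → ¬ p ∣ m) → m ∣ 1
  no-prime-divisor⇒∣1 m no-p∣m with factorise m
  ... | record { factors = [] ; isFactorisation = m≡1 } = subst (_∣ 1) (sym m≡1) ∣-refl
  ... | record { factors = q ∷ qs ; isFactorisation = m≡q*qs ; factorsPrime = q-prime All.∷ _ } =
    contradiction (subst (q ∣_) (sym m≡q*qs) (m∣m*n (product qs))) (no-p∣m q-prime)

  squarefree∣product : ∀ ps {m} → .{{NonZero m}} → (∀ {p} → Prime p → p ∣ m → p ∈ ps) →
                       (∀ {p} → Prime p → ¬ p * p ∣ m) → m ∣ product ps
  squarefree∣product [] {m} primes∈ _ = no-prime-divisor⇒∣1 m λ pp p∣m → ¬Any[] (primes∈ pp p∣m)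
  squarefree∣product (x ∷ ps) {m} {{m≢0}} primes∈ squarefree with prime? x ×-dec x ∣? m
  ... | yes (x-prime , divides q m≡q*x) = subst (_∣ x * product ps) (sym m≡x*q) (*-monoʳ-∣ x q∣ps)
    where
    m≡x*q : m ≡ x * q
    m≡x*q = trans m≡q*x (*-comm q x)
    q∣m : q ∣ m
    q∣m = divides x m≡x*q
    primes∈q : ∀ {p} → Prime p → p ∣ q → p ∈ ps
    primes∈q pp p∣q with primes∈ pp (∣-trans p∣q q∣m)
    ... | here refl  = contradiction (subst (x * x ∣_) (sym m≡x*q) (*-monoʳ-∣ x p∣q)) (squarefree pp)
    ... | there p∈ps = p∈ps
    q∣ps : q ∣ product ps
    q∣ps = squarefree∣product ps {{m*n≢0⇒m≢0 q {{subst NonZero m≡q*x m≢0}}}} primes∈q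
                              (λ pp p*p∣q → squarefree pp (∣-trans p*p∣q q∣m))
  ... | no ¬[x-prime×x∣m] = ∣-trans (squarefree∣product ps primes∈ps squarefree) (n∣m*n x)
    where
    primes∈ps : ∀ {p} → Prime p → p ∣ m → p ∈ ps
    primes∈ps pp p∣m with primes∈ pp p∣m
    ... | here refl  = contradiction (pp , p∣m) ¬[x-prime×x∣m]
    ... | there p∈ps = p∈ps

  ∣m⊖n∣≡m+n : ∀ {m n} → m ≡ 0 ⊎ n ≡ 0 → ∣ m ⊖ n ∣ ≡ m + n
  ∣m⊖n∣≡m+n     (inj₁ refl) = ℤ.∣⊖∣-≤ z≤n
  ∣m⊖n∣≡m+n {m} (inj₂ refl) =
    trans (ℤ.∣m⊖n∣≡∣n⊖m∣ m 0) (trans (ℤ.∣⊖∣-≤ z≤n) (sym (+-identityʳ m)))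

  unique-⊆⇒length≤ : ∀ {A : Set} → DecidableEquality A → {xs ys : List A} → Unique xs → xs ⊆ ys →
                     length xs ≤ length ys
  unique-⊆⇒length≤ _≟_ {[]}     _                            _        = z≤n
  unique-⊆⇒length≤ {A} _≟_ {x ∷ xs} {ys} (x∉xs AllPairs.∷ xs-unique) x∷xs⊆ys = begin
    suc (length xs)                     ≤⟨ s≤s (unique-⊆⇒length≤ _≟_ xs-unique xs⊆ys-x) ⟩
    suc (length (filter (x ≢?_) ys))    ≤⟨ filter-notAll (x ≢?_) ys (Any.map (λ x≡y x≢y → x≢y x≡y) x∈ys) ⟩
    length ys                           ∎
    where
    open ≤-Reasoning
    x∈ys : x ∈ ys
    x∈ys = x∷xs⊆ys (here refl)
    _≢?_ : (x y : A) → Dec (x ≢ y)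
    x ≢? y = ¬? (x ≟ y)
    xs⊆ys-x : xs ⊆ filter (x ≢?_) ys
    xs⊆ys-x y∈xs = ∈-filter⁺ (x ≢?_) (x∷xs⊆ys (there y∈xs)) (All.lookup x∉xs y∈xs)

  length-cartesianProduct : ∀ {A B : Set} (xs : List A) (ys : List B) →
                            length (cartesianProduct xs ys) ≡ length xs * length ys
  length-cartesianProduct []       ys = refl
  length-cartesianProduct (x ∷ xs) ys = begin
    length (map (x ,_) ys ++ cartesianProduct xs ys)
      ≡⟨ length-++ (map (x ,_) ys) ⟩
    length (map (x ,_) ys) + length (cartesianProduct xs ys)
      ≡⟨ cong₂ _+_ (length-map (x ,_) ys) (length-cartesianProduct xs ys) ⟩
    length ys + length xs * length ys
      ∎
    where open ≡-Reasoning

  ∈-applyUpTo-suc⁺ : ∀ {i n} → 0 < i → i ≤ n → i ∈ applyUpTo suc n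
  ∈-applyUpTo-suc⁺ {suc i} _ i<n = ∈-applyUpTo⁺ suc i<n

  length≤*-of-injective-pair : ∀ {A : Set} {m n} (f g : A → ℕ) →
                               (∀ {x y} → f x ≡ f y → g x ≡ g y → x ≡ y) → ∀ {xs} → Unique xs →
                               All (λ x → (0 < f x × f x ≤ m) × (0 < g x × g x ≤ n)) xs →
                               length xs ≤ m * n
  length≤*-of-injective-pair {A} {m} {n} f g f-g-injective {xs} xs-unique in-box = begin
    length xs
      ≡⟨ length-map h xs ⟨
    length (map h xs)
      ≤⟨ unique-⊆⇒length≤ (≡-dec _≟_ _≟_) (Unique.map⁺ h-injective xs-unique) map⊆box ⟩
    length box
      ≡⟨ length-cartesianProduct (applyUpTo suc m) (applyUpTo suc n) ⟩
    length (applyUpTo suc m) * length (applyUpTo suc n)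
      ≡⟨ cong₂ _*_ (length-applyUpTo suc m) (length-applyUpTo suc n) ⟩
    m * n
      ∎
    where
    open ≤-Reasoning
    h : A → ℕ × ℕ
    h x = f x , g x
    box : List (ℕ × ℕ)
    box = cartesianProduct (applyUpTo suc m) (applyUpTo suc n)
    h-injective : ∀ {x y} → h x ≡ h y → x ≡ y
    h-injective h≡ = f-g-injective (cong proj₁ h≡) (cong proj₂ h≡)
    map⊆box : map h xs ⊆ box
    map⊆box z∈ with x , x∈xs , refl ← ∈-map⁻ h z∈ with (f>0 , f≤m) , (g>0 , g≤n) ← All.lookup in-box x∈xs =
      ∈-cartesianProduct⁺ (∈-applyUpTo-suc⁺ f>0 f≤m) (∈-applyUpTo-suc⁺ g>0 g≤n)

  m*m≤n*n⇒m≤n : ∀ {m n} → m * m ≤ n * n → m ≤ n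
  m*m≤n*n⇒m≤n m*m≤n*n = ≮⇒≥ λ n<m → <⇒≱ (*-mono-< n<m n<m) m*m≤n*n

  2*[m*n]≤[2*n]*[2*n] : ∀ {m n} → m ≤ n → 2 * (m * n) ≤ 2 * n * (2 * n)
  2*[m*n]≤[2*n]*[2*n] {m} {n} m≤n = begin
    2 * (m * n)        ≤⟨ *-monoʳ-≤ 2 (*-monoˡ-≤ n m≤n) ⟩
    2 * (n * n)        ≡⟨ *-assoc 2 n n ⟨
    2 * n * n          ≤⟨ *-monoʳ-≤ (2 * n) (m≤n*m n 2) ⟩
    2 * n * (2 * n)    ∎
    where open ≤-Reasoning

  k*k≤2*[m*n]⇒k≤2*m⊎k≤2*n : ∀ {k m n} → k * k ≤ 2 * (m * n) → k ≤ 2 * m ⊎ k ≤ 2 * n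
  k*k≤2*[m*n]⇒k≤2*m⊎k≤2*n {k} {m} {n} k*k≤2mn with ≤-total m n
  ... | inj₁ m≤n = inj₂ (m*m≤n*n⇒m≤n (≤-trans k*k≤2mn (2*[m*n]≤[2*n]*[2*n] m≤n)))
  ... | inj₂ n≤m = inj₁ (m*m≤n*n⇒m≤n (≤-trans k*k≤2mn (subst (_≤ 2 * m * (2 * m)) (cong (2 *_) (*-comm n m))
                                                            (2*[m*n]≤[2*n]*[2*n] n≤m))))

  cross-identity : ∀ {N a b u v u′ v′} → a * v ≡ N * u → b * v′ ≡ N * u′ →
                   u * v′ * (u * v′) * b ≡ u * v * (u′ * v′) * a
  cross-identity {N} {a} {b} {u} {v} {u′} {v′} av≡Nu bv′≡Nu′ = begin
    u * v′ * (u * v′) * b    ≡⟨ solve (u ∷ v′ ∷ b ∷ []) ⟩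
    u * u * v′ * (b * v′)    ≡⟨ cong (u * u * v′ *_) bv′≡Nu′ ⟩
    u * u * v′ * (N * u′)    ≡⟨ solve (u ∷ v′ ∷ N ∷ u′ ∷ []) ⟩
    u * u′ * v′ * (N * u)    ≡⟨ cong (u * u′ * v′ *_) av≡Nu ⟨
    u * u′ * v′ * (a * v)    ≡⟨ solve (u ∷ u′ ∷ v′ ∷ a ∷ v ∷ []) ⟩
    u * v * (u′ * v′) * a    ∎
    where open ≡-Reasoning

  module _ (N : ℕ) .{{_ : NonZero N}} where

    private
      gcd≢0 : ∀ a → NonZero (gcd a N)
      gcd≢0 a = ≢-nonZero (gcd[m,n]≢0 a N (inj₂ (≢-nonZero⁻¹ N)))

      defect-prime? : ∀ a p → Dec (Prime p × ¬ val p a ≡ val p N)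
      defect-prime? a p = prime? p ×-dec ¬? (val p a ≟ val p N)

    num den : ℕ → ℕ
    num a = (a / gcd a N) {{gcd≢0 a}}
    den a = (N / gcd a N) {{gcd≢0 a}}

    num≢0 : ∀ a → .{{NonZero a}} → NonZero (num a)
    num≢0 a = ≢-nonZero (m/gcd[m,n]≢0 a N {{gcd≢0 = gcd≢0 a}})

    den≢0 : ∀ a → NonZero (den a)
    den≢0 a = ≢-nonZero (n/gcd[m,n]≢0 a N {{gcd≢0 = gcd≢0 a}})

    gcd*num≡a : ∀ a → gcd a N * num a ≡ a
    gcd*num≡a a = m*[n/m]≡n {{gcd≢0 a}} (gcd[m,n]∣m a N)

    gcd*den≡N : ∀ a → gcd a N * den a ≡ N
    gcd*den≡N a = m*[n/m]≡n {{gcd≢0 a}} (gcd[m,n]∣n a N)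

    num∣a : ∀ a → num a ∣ a
    num∣a a = divides (gcd a N) (sym (gcd*num≡a a))

    den∣N : ∀ a → den a ∣ N
    den∣N a = divides (gcd a N) (sym (gcd*den≡N a))

    a*den≡N*num : ∀ a → a * den a ≡ N * num a
    a*den≡N*num a = begin
      a * den a                  ≡⟨ cong (_* den a) (gcd*num≡a a) ⟨
      gcd a N * num a * den a    ≡⟨ xy∙z≈xz∙y *-commutativeSemigroup (gcd a N) (num a) (den a) ⟩
      gcd a N * den a * num a    ≡⟨ cong (_* num a) (gcd*den≡N a) ⟩
      N * num a                  ∎
      where open ≡-Reasoning

    num-den-injective : ∀ {a b} → num a ≡ num b → den a ≡ den b → a ≡ b
    num-den-injective {a} {b} num≡ den≡ = *-cancelʳ-≡ a b (den a) {{den≢0 a}} (begin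
      a * den a    ≡⟨ a*den≡N*num a ⟩
      N * num a    ≡⟨ cong (N *_) num≡ ⟩
      N * num b    ≡⟨ a*den≡N*num b ⟨
      b * den b    ≡⟨ cong (b *_) den≡ ⟨
      b * den a    ∎)
      where open ≡-Reasoning

    ∣vq∣≡val[num*den] : ∀ {p} → Prime p → ∀ a → .{{NonZero a}} → ∣ vq p a N ∣ ≡ val p (num a * den a)
    ∣vq∣≡val[num*den] {p} pp a = begin
      ∣ vq p a N ∣             ≡⟨ cong ∣_∣ (ℤ.m-n≡m⊖n (val p a) (val p N)) ⟩
      ∣ val p a ⊖ val p N ∣    ≡⟨ cong₂ (λ x y → ∣ x ⊖ y ∣) (val[gcd*m] (gcd*num≡a a) {{num≢0 a}})
                                                            (val[gcd*m] (gcd*den≡N a) {{den≢0 a}}) ⟩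
      ∣ (g + u) ⊖ (g + v) ∣    ≡⟨ cong ∣_∣ (ℤ.+-cancelˡ-⊖ g u v) ⟩
      ∣ u ⊖ v ∣                ≡⟨ ∣m⊖n∣≡m+n (coprime⇒val≡0⊎val≡0 (coprime-/gcd a N {{gcd≢0 a}})) ⟩
      u + v                    ≡⟨ val-homo-* pp (num a) (den a) {{num≢0 a}} {{den≢0 a}} ⟨
      val p (num a * den a)    ∎
      where
      open ≡-Reasoning
      instance _ = prime⇒nonTrivial pp
      g u v : ℕ
      g = val p (gcd a N)
      u = val p (num a)
      v = val p (den a)
      val[gcd*m] : ∀ {m n} → gcd a N * m ≡ n → .{{NonZero m}} → val p n ≡ g + val p m
      val[gcd*m] {m} refl = val-homo-* pp (gcd a N) m {{gcd≢0 a}}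

    num*den∣defect : ∀ a → .{{NonZero a}} → (∀ p → Prime p → ∣ vq p a N ∣ ≤ 1) → num a * den a ∣ defect a N
    num*den∣defect a vq≤1 = squarefree∣product _ {{M≢0}} prime∈defect squarefree
      where
      M : ℕ
      M = num a * den a
      .M≢0 : NonZero M
      M≢0 = m*n≢0 (num a) (den a) {{num≢0 a}} {{den≢0 a}}

      p^k∣M⇒k≤∣vq∣ : ∀ {p k} → Prime p → p ^ k ∣ M → k ≤ ∣ vq p a N ∣
      p^k∣M⇒k≤∣vq∣ pp p^k∣M =
        subst (_ ≤_) (sym (∣vq∣≡val[num*den] pp a)) (p^k∣n⇒k≤val {{prime⇒nonTrivial pp}} pp {{M≢0}} p^k∣M)

      squarefree : ∀ {p} → Prime p → ¬ p * p ∣ M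
      squarefree {p} pp p*p∣M = <⇒≱ (s≤s (s≤s z≤n))
        (≤-trans (p^k∣M⇒k≤∣vq∣ {k = 2} pp (subst (_∣ M) (cong (p *_) (sym (*-identityʳ p))) p*p∣M)) (vq≤1 p pp))

      val≢ : ∀ {p} → Prime p → p ∣ M → ¬ val p a ≡ val p N
      val≢ {p} pp p∣M val≡ = <⇒≱ (s≤s z≤n)
        (subst (1 ≤_) ∣vq∣≡0 (p^k∣M⇒k≤∣vq∣ {k = 1} pp (subst (_∣ M) (sym (*-identityʳ p)) p∣M)))
        where
        ∣vq∣≡0 : ∣ vq p a N ∣ ≡ 0
        ∣vq∣≡0 = cong ∣_∣ (trans (ℤ.m-n≡m⊖n (val p a) (val p N))
                                (trans (cong (val p a ⊖_) (sym val≡)) (ℤ.n⊖n≡0 (val p a))))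

      p≤a+N : ∀ {p} → Prime p → p ∣ M → p ≤ a + N
      p≤a+N pp p∣M with euclidsLemma (num a) (den a) pp p∣M
      ... | inj₁ p∣num = ≤-trans (∣⇒≤ (∣-trans p∣num (num∣a a))) (m≤m+n a N)
      ... | inj₂ p∣den = ≤-trans (∣⇒≤ (∣-trans p∣den (den∣N a))) (m≤n+m N a)

      prime∈defect : ∀ {p} → Prime p → p ∣ M → p ∈ filter (defect-prime? a) (upTo (suc (a + N)))
      prime∈defect pp p∣M = ∈-filter⁺ (defect-prime? a) (∈-upTo⁺ (s≤s (p≤a+N pp p∣M))) (pp , val≢ pp p∣M)

    num*den≤defect : ∀ a → .{{NonZero a}} → (∀ p → Prime p → ∣ vq p a N ∣ ≤ 1) → num a * den a ≤ defect a N
    num*den≤defect a vq≤1 = ∣⇒≤ {{defect≢0}} (num*den∣defect a vq≤1)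
      where
      defect≢0 : NonZero (defect a N)
      defect≢0 = productOfPrimes≢0 (All.map proj₁ (all-filter (defect-prime? a) (upTo (suc (a + N)))))

    length≤2*num*den : ∀ x xs → Unique (x ∷ xs) → All NonZero (x ∷ xs) →
                       (∀ {a b} → a ∈ x ∷ xs → b ∈ x ∷ xs → a ≤ 2 * b) →
                       ∃ λ a → a ∈ x ∷ xs × length (x ∷ xs) ≤ 2 * (num a * den a)
    length≤2*num*den x xs unique nonZero a≤2b = pick (k*k≤2*[m*n]⇒k≤2*m⊎k≤2*n {K} {P₁} {P₂} K*K≤2*P₁*P₂)
      where
      argmax∈ : ∀ f → argmax f x xs ∈ x ∷ xs
      argmax∈ f = argmax-all f (here refl) (All.tabulate there)
      ≤argmax : ∀ f → All (λ a → f a ≤ f (argmax f x xs)) (x ∷ xs)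
      ≤argmax f = f[⊥]≤f[argmax] {f = f} x xs All.∷ f[xs]≤f[argmax] {f = f} x xs
      a₁ a₂ K P₁ P₂ : ℕ
      a₁ = argmax num x xs
      a₂ = argmax den x xs
      K  = num a₁ * den a₂
      P₁ = num a₁ * den a₁
      P₂ = num a₂ * den a₂

      length≤K : length (x ∷ xs) ≤ K
      length≤K = length≤*-of-injective-pair num den num-den-injective unique (All.tabulate in-box)
        where
        in-box : ∀ {a} → a ∈ x ∷ xs → (0 < num a × num a ≤ num a₁) × (0 < den a × den a ≤ den a₂)
        in-box {a} a∈ = (>-nonZero⁻¹ (num a) {{num≢0 a {{All.lookup nonZero a∈}}}} , All.lookup (≤argmax num) a∈)
                      , (>-nonZero⁻¹ (den a) {{den≢0 a}} , All.lookup (≤argmax den) a∈)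

      K*K≤2*P₁*P₂ : K * K ≤ 2 * (P₁ * P₂)
      K*K≤2*P₁*P₂ = *-cancelʳ-≤ (K * K) (2 * (P₁ * P₂)) a₂ {{All.lookup nonZero (argmax∈ den)}} (begin
        K * K * a₂            ≡⟨ cross-identity {N} {a₁} {a₂} {num a₁} {den a₁} {num a₂} {den a₂}
                                                (a*den≡N*num a₁) (a*den≡N*num a₂) ⟩
        P₁ * P₂ * a₁          ≤⟨ *-monoʳ-≤ (P₁ * P₂) (a≤2b (argmax∈ num) (argmax∈ den)) ⟩
        P₁ * P₂ * (2 * a₂)    ≡⟨ x∙yz≈yx∙z *-commutativeSemigroup (P₁ * P₂) 2 a₂ ⟩
        2 * (P₁ * P₂) * a₂    ∎)
        where open ≤-Reasoning

      pick : K ≤ 2 * P₁ ⊎ K ≤ 2 * P₂ → ∃ λ a → a ∈ x ∷ xs × length (x ∷ xs) ≤ 2 * (num a * den a)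
      pick (inj₁ K≤2P₁) = a₁ , argmax∈ num , ≤-trans length≤K K≤2P₁
      pick (inj₂ K≤2P₂) = a₂ , argmax∈ den , ≤-trans length≤K K≤2P₂

  private
    mkℚ[n/1] : ℕ → ℚ
    mkℚ[n/1] n = mkℚ (ℤ.+ n) 0 (Coprime.sym (1-coprimeTo n))

  ℕ→ℚ≡mkℚ[n/1] : ∀ n → ℕ→ℚ n ≡ mkℚ[n/1] n
  ℕ→ℚ≡mkℚ[n/1] n = ↥p/↧p≡p (mkℚ[n/1] n)

  ℕ→ℚ-mono-≤ : ∀ {m n} → m ≤ n → ℕ→ℚ m ℚ.≤ ℕ→ℚ n
  ℕ→ℚ-mono-≤ {m} {n} m≤n = subst₂ ℚ._≤_ (sym (ℕ→ℚ≡mkℚ[n/1] m)) (sym (ℕ→ℚ≡mkℚ[n/1] n))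
    (*≤* (subst₂ ℤ._≤_ (sym (ℤ.*-identityʳ (ℤ.+ m))) (sym (ℤ.*-identityʳ (ℤ.+ n))) (+≤+ m≤n)))

  ℕ→ℚ-cancel-≤ : ∀ {m n} → ℕ→ℚ m ℚ.≤ ℕ→ℚ n → m ≤ n
  ℕ→ℚ-cancel-≤ {m} {n} m≤ℚn
    with *≤* m*1≤n*1 ← subst₂ ℚ._≤_ (ℕ→ℚ≡mkℚ[n/1] m) (ℕ→ℚ≡mkℚ[n/1] n) m≤ℚn
    with +≤+ m≤n ← subst₂ ℤ._≤_ (ℤ.*-identityʳ (ℤ.+ m)) (ℤ.*-identityʳ (ℤ.+ n)) m*1≤n*1 = m≤n

  ℕ→ℚ-homo-* : ∀ m n → ℕ→ℚ (m * n) ≡ ℕ→ℚ m ℚ.* ℕ→ℚ n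
  ℕ→ℚ-homo-* m n = begin
    ℕ→ℚ (m * n)                  ≡⟨ ℕ→ℚ≡mkℚ[n/1] (m * n) ⟩
    mkℚ[n/1] (m * n)             ≡⟨ toℚᵘ-injective (ℚᵘ.≃-trans (ℚᵘ.*≡* (cong (ℤ._* ℤ.+ 1) (ℤ.pos-* m n)))
                                                               (ℚᵘ.≃-sym (toℚᵘ-homo-* (mkℚ[n/1] m) (mkℚ[n/1] n)))) ⟩
    mkℚ[n/1] m ℚ.* mkℚ[n/1] n    ≡⟨ cong₂ ℚ._*_ (ℕ→ℚ≡mkℚ[n/1] m) (ℕ→ℚ≡mkℚ[n/1] n) ⟨
    ℕ→ℚ m ℚ.* ℕ→ℚ n              ∎
    where open ≡-Reasoning

  ℕ→ℚ[c*n]≤c*q : ∀ c {n q} → ℕ→ℚ n ℚ.≤ q → ℕ→ℚ (c * n) ℚ.≤ ℕ→ℚ c ℚ.* q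
  ℕ→ℚ[c*n]≤c*q c {n} n≤q = ℚ.≤-trans (ℚ.≤-reflexive (ℕ→ℚ-homo-* c n))
    (ℚ.*-monoˡ-≤-nonNeg (ℕ→ℚ c) {{ℚ.nonNegative (ℕ→ℚ-mono-≤ {0} {c} z≤n)}} n≤q)

  Dyadic : ℚ → ℕ → Set
  Dyadic X a = X ℚ.≤ ℕ→ℚ a × ℕ→ℚ a ℚ.≤ ℕ→ℚ 2 ℚ.* X

  Dyadic⇒NonZero : ∀ {X a} → 1ℚ ℚ.≤ X → Dyadic X a → NonZero a
  Dyadic⇒NonZero 1≤X (X≤a , _) = >-nonZero (ℕ→ℚ-cancel-≤ {1} (ℚ.≤-trans 1≤X X≤a))

  Dyadic⇒≤2* : ∀ {X a b} → Dyadic X a → Dyadic X b → a ≤ 2 * b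
  Dyadic⇒≤2* {a = a} {b} (_ , a≤2X) (X≤b , _) = ℕ→ℚ-cancel-≤ {a} {2 * b}
    (ℚ.≤-trans a≤2X (ℚ.≤-trans (ℚ.*-monoˡ-≤-nonNeg (ℕ→ℚ 2) X≤b) (ℚ.≤-reflexive (sym (ℕ→ℚ-homo-* 2 b)))))

  small-defect-count : ∀ {X T} N .{{_ : NonZero N}} → 1ℚ ℚ.≤ X → 0ℚ ℚ.≤ T →
                       (L : List ℕ) → Unique L →
                       All (λ a → Dyadic X a × (∀ p → Prime p → ∣ vq p a N ∣ ≤ 1) × ℕ→ℚ (defect a N) ℚ.≤ T) L →
                       ℕ→ℚ (length L) ℚ.≤ ℕ→ℚ 2 ℚ.* T
  small-defect-count {T = T} N 1≤X 0≤T [] _ _ = ℕ→ℚ[c*n]≤c*q 2 {0} {T} 0≤T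
  small-defect-count {X} N 1≤X 0≤T L@(x ∷ xs) unique hyps =
    let a , a∈L , length≤2*num*den[a] =
          length≤2*num*den N x xs unique (All.map (λ h → Dyadic⇒NonZero 1≤X (proj₁ h)) hyps)
            (λ {a} {b} a∈L b∈L → Dyadic⇒≤2* {X} {a} {b} (proj₁ (All.lookup hyps a∈L))
                                                          (proj₁ (All.lookup hyps b∈L)))
        a-dyadic , vq≤1 , defect≤T = All.lookup hyps a∈L
        num*den≤defect[a] = num*den≤defect N a {{Dyadic⇒NonZero 1≤X a-dyadic}} vq≤1
    in ℚ.≤-trans (ℕ→ℚ-mono-≤ {length L} {2 * defect a N}
                   (≤-trans length≤2*num*den[a] (*-monoʳ-≤ 2 num*den≤defect[a])))
                 (ℕ→ℚ[c*n]≤c*q 2 {defect a N} defect≤T)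

open import Data.Nat as ℕ using (ℕ; _<_)
open import Data.Nat.GCD using (gcd)
open import Data.Nat.Primality using (Prime)
open import Data.Integer as ℤ using (∣_∣)
open import Data.Rational as ℚ using (ℚ; _≤_; 0ℚ; 1ℚ; ½; _*_)
open import Data.List using (List; length)
open import Data.List.Membership.Propositional using (_∈_)
open import Data.List.Relation.Unary.All using (All)
open import Data.List.Relation.Unary.Unique.Propositional using (Unique)
open import Data.Product using (_×_; _,_; ∃)
open import Relation.Binary.PropositionalEquality using (_≡_)
import Data.List.Relation.Unary.All as All
import Data.Nat.Properties as ℕ
import Data.Rational.Properties as ℚ
open DefectCount using (Dyadic; small-defect-count)

lemma4p1 : (X Y D δ : ℚ) → 1ℚ ≤ X → 1ℚ ≤ Y → 1ℚ ≤ D → D ≤ X → D ≤ Y →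
    0ℚ ℚ.< δ → δ ≤ 1ℚ →
    (A B : List ℕ) → Unique A → Unique B →
    All (λ a → X ≤ ℕ→ℚ a × ℕ→ℚ a ≤ ℕ→ℚ 2 * X) A →
    All (λ b → Y ≤ ℕ→ℚ b × ℕ→ℚ b ≤ ℕ→ℚ 2 * Y) B →
    (Ω : List (ℕ × ℕ)) → Unique Ω →
    (∀ {a b} → (a , b) ∈ Ω → a ∈ A × b ∈ B) →
    ℕ→ℚ (length Ω) ≡ (δ * ½) * (ℕ→ℚ (length A) * ℕ→ℚ (length B)) →
    (∀ {a b} → (a , b) ∈ Ω → D ≤ ℕ→ℚ (gcd a b)) →
    (N : ℕ) → 0 < N →
    (∀ p → Prime p → ∀ {a b} → (a , b) ∈ Ω →
      ∣ vq p a N ∣ ℕ.+ ∣ vq p b N ∣ ℕ.≤ 1) →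
    (∀ (T : ℚ) → 0ℚ ℚ.< T →
      ((L : List ℕ) → Unique L →
        All (λ a → (a ∈ A × ∃ λ b → b ∈ B × (a , b) ∈ Ω) × ℕ→ℚ (defect a N) ≤ T) L →
        ℕ→ℚ (length L) ≤ ℕ→ℚ 2 * T)
      × ((L : List ℕ) → Unique L →
        All (λ b → (b ∈ B × ∃ λ a → a ∈ A × (a , b) ∈ Ω) × ℕ→ℚ (defect b N) ≤ T) L →
        ℕ→ℚ (length L) ≤ ℕ→ℚ 2 * T))

lemma4p1 X Y _ _ 1≤X 1≤Y _ _ _ _ _ A B _ _ A⊆[X,2X] B⊆[Y,2Y] Ω _ _ _ _ N 0<N vq≤1 T 0<T =
    (λ L unique hyps → small-defect-count N 1≤X 0≤T L unique (All.map from-A hyps))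
  , (λ L unique hyps → small-defect-count N 1≤Y 0≤T L unique (All.map from-B hyps))
  where
  instance
    N≢0 : ℕ.NonZero N
    N≢0 = ℕ.>-nonZero 0<N
  0≤T : 0ℚ ≤ T
  0≤T = ℚ.<⇒≤ 0<T
  from-A : ∀ {a} → (a ∈ A × ∃ λ b → b ∈ B × (a , b) ∈ Ω) × ℕ→ℚ (defect a N) ≤ T →
           Dyadic X a × (∀ p → Prime p → ∣ vq p a N ∣ ℕ.≤ 1) × ℕ→ℚ (defect a N) ≤ T
  from-A ((a∈A , _ , _ , ab∈Ω) , defect≤T) =
    All.lookup A⊆[X,2X] a∈A , (λ p pp → ℕ.≤-trans (ℕ.m≤m+n _ _) (vq≤1 p pp ab∈Ω)) , defect≤T
  from-B : ∀ {b} → (b ∈ B × ∃ λ a → a ∈ A × (a , b) ∈ Ω) × ℕ→ℚ (defect b N) ≤ T →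
           Dyadic Y b × (∀ p → Prime p → ∣ vq p b N ∣ ℕ.≤ 1) × ℕ→ℚ (defect b N) ≤ T
  from-B ((b∈B , _ , _ , ab∈Ω) , defect≤T) =
    All.lookup B⊆[Y,2Y] b∈B , (λ p pp → ℕ.≤-trans (ℕ.m≤n+m _ _) (vq≤1 p pp ab∈Ω)) , defect≤T
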